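{- Let $G$ be a digraph, $S,T\subseteq V(G)$ disjoint, and $k$ a nonnegative integer. Suppose $G$ has a gapless $S$--$T$ chain of order at most $k$ and $|V(G)\setminus(S\cup T)|\ge k+2$. Then there exist a gapless $S$--$T$ chain $((A_0,B_0),\dots,(A_r,B_r))$ of order at most $k$ and distinct vertices $u\in V(G)\setminus(S\cup N^-[T])$ and $v\in V(G)\setminus(T\cup N^+[S])$ such that: (1) $((A_1,B_1),\dots,(A_r,B_r))$ is an $(S\cup\{u\})$--$T$ chain; (2) $((A_0,B_0),\dots,(A_{r-1},B_{r-1}))$ is an $S$--$(T\cup\{v\})$ chain; and (3) $((A_1,B_1),\dots,(A_{r-1},B_{r-1}))$ is an $(S\cup\{u\})$--$(T\cup\{v\})$ chain.
   Context: For $v\in V(G)$, $N^\pm(v)$ is its set of out-/in-neighbors, $N^\pm[v]=N^\pm(v)\cup\{v\}$, $N^\pm[U]=\bigcup_{v\in U}N^\pm[v]$. A separation of $G$ is a pair $(A,B)$ with $A\cup B=V(G)$ and no edge from $A\setminus B$ to $B\setminus A$; its order is $|A\cap B|$. A separation chain is a sequence $((A_0,B_0),\dots,(A_r,B_r))$ of separations with $A_0\subseteq\dots\subseteq A_r$, $B_r\subseteq\dots\subseteq B_0$; its order is the maximum order of its members; it is gapless if for every $0<i\le r$, $|A_i\setminus A_{i-1}|\le1$ or $|B_{i-1}\setminus B_i|\le1$. For disjoint $S',T'$, it is an $S'$--$T'$ chain if $B_0=V(G)\setminus S'$ and $A_r=V(G)\setminus T'$ (here $B_0$, $A_r$ denote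 the first and last members of the chain in question). -}

module Defs where

open import Data.Nat using (ℕ; zero; suc; _≤_)
open import Data.Fin using (Fin)
open import Data.Fin.Subset using (Subset; _∈_; _∉_; _⊆_; _∪_; _∩_; _─_; ∁; ∣_∣)
open import Data.Bool using (Bool; true; false)
open import Data.Product using (Σ; _×_; _,_; proj₁; proj₂)
open import Data.Sum using (_⊎_)
open import Relation.Binary.PropositionalEquality using (_≡_)

record Digraph : Set where
  field
    size : ℕ
    edge : Fin size → Fin size → Bool
open Digraph public

V : Digraph → Set
V G = Fin (size G)

VSet : Digraph → Set
VSet G = Subset (size G)

Pair : Digraph → Set
Pair G = VSet G × VSet G

IsSeparation : (G : Digraph) → Pair G → Set
IsSeparation G (A , B) =
  (∀ x → x ∈ A ⊎ x ∈ B) ×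
  (∀ x y → x ∈ A → x ∉ B → y ∈ B → y ∉ A → edge G x y ≡ false)

order : {G : Digraph} → Pair G → ℕ
order (A , B) = ∣ A ∩ B ∣

-- A sequence of pairs with members C 0, ..., C r (indices > r are ignored).
-- It is a separation chain if every member is a separation and the A's
-- increase and the B's decrease.
IsSepChain : (G : Digraph) (r : ℕ) → (ℕ → Pair G) → Set
IsSepChain G r C =
  (∀ i → i ≤ r → IsSeparation G (C i)) ×
  (∀ i → suc i ≤ r →
     proj₁ (C i) ⊆ proj₁ (C (suc i)) × proj₂ (C (suc i)) ⊆ proj₂ (C i))

ChainOrder≤ : (G : Digraph) (r : ℕ) → (ℕ → Pair G) → ℕ → Set
ChainOrder≤ G r C k = ∀ i → i ≤ r → order {G} (C i) ≤ k

Gapless : (G : Digraph) (r : ℕ) → (ℕ → Pair G) → Set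
Gapless G r C = ∀ j → suc j ≤ r →
  ∣ proj₁ (C (suc j)) ─ proj₁ (C j) ∣ ≤ 1 ⊎ ∣ proj₂ (C j) ─ proj₂ (C (suc j)) ∣ ≤ 1

Disjoint : {G : Digraph} → VSet G → VSet G → Set
Disjoint {G} S T = ∀ (x : V G) → x ∈ S → x ∉ T

IsSTChain : (G : Digraph) (S' T' : VSet G) (r : ℕ) → (ℕ → Pair G) → Set
IsSTChain G S' T' r C =
  Disjoint {G} S' T' × IsSepChain G r C ×
  proj₂ (C 0) ≡ ∁ S' × proj₁ (C r) ≡ ∁ T'

InClosedInNbhd : (G : Digraph) → VSet G → V G → Set
InClosedInNbhd G T x = x ∈ T ⊎ Σ (V G) (λ t → t ∈ T × edge G x t ≡ true)

InClosedOutNbhd : (G : Digraph) → VSet G → V G → Set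
InClosedOutNbhd G S x = x ∈ S ⊎ Σ (V G) (λ s → s ∈ S × edge G s x ≡ true)

-- Let j be the last index with B_j = V ∖ S and l + 1 the first with A_{l+1} = V ∖ T.
-- Every gapless step (A , B) → (A′ , B′) between separations of order ≤ k has
-- |A′ ∩ B| ≤ k + 1, so since |V ∖ (S ∪ T)| ≥ k + 2 no single step (and no single
-- separation) can have B = V ∖ S and A′ = V ∖ T; hence j < l.  Pick u ∈ B_j ∖ B_{j+1}
-- and v ∈ A_{l+1} ∖ A_l, keep the members j, …, l + 1 of the chain, and insert
-- (A_{j+1} , V ∖ (S ∪ {u})) after the first and (V ∖ (T ∪ {v}) , B_l) before the last.
-- These are separations of order ≤ k because they omit u (resp. v) from the crossing
-- set A_{j+1} ∩ B_j (resp. A_{l+1} ∩ B_l) of size ≤ k + 1; u lies in A_{j+1} ∖ B_{j+1} and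
-- v in B_l ∖ A_l, so no edge joins u to T or S to v.

module Submission where

open import Data.Empty as Empty using (⊥-elim)
open import Data.Fin using (Fin)
open import Data.Fin.Properties using (any?)
open import Data.Fin.Subset
open import Data.Fin.Subset.Properties
open import Data.Nat
  using (ℕ; zero; suc; _≤_; _<_; _+_; _∸_; z≤n; s≤s; _≤′_; ≤′-refl; ≤′-step; _≤?_)
open import Data.Nat.Properties
  using (≤-refl; ≤-trans; ≤-pred; <⇒≤; n≤1+n; +-mono-≤; +-monoˡ-≤; +-suc; +-comm;
         m∸n+n≡m; ≤⇒≤′; ≰⇒>; 1+n≰n; module ≤-Reasoning)
open import Data.Vec using ([]; _∷_; here; there)
open import Data.Product using (Σ; ∃; _×_; _,_; proj₁; proj₂)
open import Data.Sum using (_⊎_; inj₁; inj₂; [_,_]; map₁; map₂)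
open import Function using (_∘_; id)
open import Relation.Binary.PropositionalEquality hiding ([_])
open import Relation.Nullary using (¬_; yes; no; ¬?; _×-dec_; contradiction)
open import Relation.Nullary.Decidable using (decidable-stable)
open import Relation.Unary using (Decidable)

open import Defs

private
  variable
    n : ℕ
    p q r : Subset n
    x y : Fin n

∣p∪q∣≤∣p∣+∣q∣ : ∀ (p q : Subset n) → ∣ p ∪ q ∣ ≤ ∣ p ∣ + ∣ q ∣
∣p∪q∣≤∣p∣+∣q∣ []            []            = z≤n
∣p∪q∣≤∣p∣+∣q∣ (inside  ∷ p) (b ∷ q)       =
  s≤s (≤-trans (∣p∪q∣≤∣p∣+∣q∣ p q) (+-mono-≤ (≤-refl {∣ p ∣}) (∣p∣≤∣x∷p∣ b q)))
∣p∪q∣≤∣p∣+∣q∣ (outside ∷ p) (inside  ∷ q) rewrite +-suc ∣ p ∣ ∣ q ∣ = s≤s (∣p∪q∣≤∣p∣+∣q∣ p q)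
∣p∪q∣≤∣p∣+∣q∣ (outside ∷ p) (outside ∷ q) = ∣p∪q∣≤∣p∣+∣q∣ p q

x∈p─q⇒x∉q : ∀ (p q : Subset n) → x ∈ p ─ q → x ∉ q
x∈p─q⇒x∉q (inside ∷ p) (outside ∷ q) here       ()
x∈p─q⇒x∉q (_ ∷ p)      (_ ∷ q)       (there x∈) (there x∈q) = x∈p─q⇒x∉q p q x∈ x∈q

p─p≡⊥ : ∀ (p : Subset n) → p ─ p ≡ ⊥
p─p≡⊥ []            = refl
p─p≡⊥ (inside  ∷ p) = cong (outside ∷_) (p─p≡⊥ p)
p─p≡⊥ (outside ∷ p) = cong (outside ∷_) (p─p≡⊥ p)

∣p─p∣≤1 : ∀ (p : Subset n) → ∣ p ─ p ∣ ≤ 1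
∣p─p∣≤1 {n} p = subst (_≤ 1) (sym (trans (cong ∣_∣ (p─p≡⊥ p)) (∣⊥∣≡0 n))) z≤n

⊈-witness : p ⊈ q → ∃ λ x → x ∈ p × x ∉ q
⊈-witness {p = p} {q} p⊈q with any? (λ x → x ∈? p ×-dec ¬? (x ∈? q))
... | yes w = w
... | no ∄x = ⊥-elim (p⊈q λ {x} x∈p → decidable-stable (x ∈? q) (λ x∉q → ∄x (x , x∈p , x∉q)))

x∉p∪⁅y⁆ : x ∉ p → x ≢ y → x ∉ p ∪ ⁅ y ⁆
x∉p∪⁅y⁆ {p = p} {y = y} x∉p x≢y x∈ = [ x∉p , x≢y ∘ x∈⁅y⁆⇒x≡y y ] (x∈p∪q⁻ p ⁅ y ⁆ x∈)

∁[p∪q]⊆∁p : ∀ (p q : Subset n) → ∁ (p ∪ q) ⊆ ∁ p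
∁[p∪q]⊆∁p p q = p⊆q⇒∁p⊇∁q (p⊆p∪q q)

∁[p∪q]⊆∁q : ∀ (p q : Subset n) → ∁ (p ∪ q) ⊆ ∁ q
∁[p∪q]⊆∁q p q = p⊆q⇒∁p⊇∁q (q⊆p∪q p q)

q⊆∁[p∪⁅x⁆] : q ⊆ ∁ p → x ∉ q → q ⊆ ∁ (p ∪ ⁅ x ⁆)
q⊆∁[p∪⁅x⁆] {q = q} q⊆∁p x∉q y∈q =
  x∉p⇒x∈∁p (x∉p∪⁅y⁆ (x∈∁p⇒x∉p (q⊆∁p y∈q)) λ y≡x → x∉q (subst (_∈ q) y≡x y∈q))

∣∁p─∁[p∪⁅x⁆]∣≤1 : ∀ (p : Subset n) x → ∣ ∁ p ─ ∁ (p ∪ ⁅ x ⁆) ∣ ≤ 1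
∣∁p─∁[p∪⁅x⁆]∣≤1 p x = subst (∣ ∁ p ─ ∁ (p ∪ ⁅ x ⁆) ∣ ≤_) (∣⁅x⁆∣≡1 x) (p⊆q⇒∣p∣≤∣q∣ ∁p─∁[p∪⁅x⁆]⊆⁅x⁆)
  where
  ∁p─∁[p∪⁅x⁆]⊆⁅x⁆ : ∁ p ─ ∁ (p ∪ ⁅ x ⁆) ⊆ ⁅ x ⁆
  ∁p─∁[p∪⁅x⁆]⊆⁅x⁆ y∈ =
    [ (λ y∈p → contradiction y∈p (x∈∁p⇒x∉p (p─q⊆p (∁ p) _ y∈))) , id ]
      (x∈p∪q⁻ p ⁅ x ⁆ (x∉∁p⇒x∈p (x∈p─q⇒x∉q (∁ p) (∁ (p ∪ ⁅ x ⁆)) y∈)))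

∣p∩r∣≤∣p─q∣+∣q∩r∣ : ∀ (p q r : Subset n) → ∣ p ∩ r ∣ ≤ ∣ p ─ q ∣ + ∣ q ∩ r ∣
∣p∩r∣≤∣p─q∣+∣q∩r∣ p q r = ≤-trans (p⊆q⇒∣p∣≤∣q∣ split) (∣p∪q∣≤∣p∣+∣q∣ (p ─ q) (q ∩ r))
  where
  split : p ∩ r ⊆ (p ─ q) ∪ (q ∩ r)
  split {x} x∈p∩r with x∈p∩q⁻ p r x∈p∩r | x ∈? q
  ... | _ , x∈r | yes x∈q = x∈p∪q⁺ (inj₂ (x∈p∩q⁺ (x∈q , x∈r)))
  ... | x∈p , _ | no x∉q  = x∈p∪q⁺ (inj₁ (x∈p∧x∉q⇒x∈p─q x∈p x∉q))

∣p∩∁[q∪⁅x⁆]∣<∣p∩∁q∣ : x ∈ p → x ∉ q → ∣ p ∩ ∁ (q ∪ ⁅ x ⁆) ∣ < ∣ p ∩ ∁ q ∣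
∣p∩∁[q∪⁅x⁆]∣<∣p∩∁q∣ {x = x} {p = p} {q = q} x∈p x∉q =
  p⊂q⇒∣p∣<∣q∣ (shrink , x , x∈p∩q⁺ (x∈p , x∉p⇒x∈∁p x∉q) , x∉lhs)
  where
  shrink : p ∩ ∁ (q ∪ ⁅ x ⁆) ⊆ p ∩ ∁ q
  shrink y∈ = let y∈p , y∈∁ = x∈p∩q⁻ p _ y∈ in x∈p∩q⁺ (y∈p , ∁[p∪q]⊆∁p q ⁅ x ⁆ y∈∁)
  x∉lhs : x ∉ p ∩ ∁ (q ∪ ⁅ x ⁆)
  x∉lhs x∈ = x∈∁p⇒x∉p (proj₂ (x∈p∩q⁻ p _ x∈)) (x∈p∪q⁺ (inj₂ (x∈⁅x⁆ x)))

∣∁[q∪⁅x⁆]∩p∣<∣∁q∩p∣ : x ∈ p → x ∉ q → ∣ ∁ (q ∪ ⁅ x ⁆) ∩ p ∣ < ∣ ∁ q ∩ p ∣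
∣∁[q∪⁅x⁆]∩p∣<∣∁q∩p∣ {p = p} {q = q} x∈p x∉q =
  subst₂ (λ a b → ∣ a ∣ < ∣ b ∣) (∩-comm p _) (∩-comm p _) (∣p∩∁[q∪⁅x⁆]∣<∣p∩∁q∣ x∈p x∉q)

boundary : ∀ {m} {P : ℕ → Set} → Decidable P → P 0 → ¬ P m →
           ∃ λ j → suc j ≤ m × P j × ¬ P (suc j)
boundary {zero}  P? p₀ ¬pₘ = contradiction p₀ ¬pₘ
boundary {suc m} P? p₀ ¬pₘ with P? 1
... | no ¬p₁ = 0 , s≤s z≤n , p₀ , ¬p₁
... | yes p₁ with boundary {m} (P? ∘ suc) p₁ ¬pₘ
...   | j , j<m , pⱼ , ¬pⱼ₊₁ = suc j , s≤s j<m , pⱼ , ¬pⱼ₊₁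

record Chain {X : Set} (P : X → Set) (Q : X → X → Set) (r : ℕ) (C : ℕ → X) : Set where
  field
    member : ∀ i → i ≤ r → P (C i)
    link   : ∀ i → suc i ≤ r → Q (C i) (C (suc i))
open Chain

module _ {X : Set} where

  _◂_ : X → (ℕ → X) → ℕ → X
  (z ◂ C) zero    = z
  (z ◂ C) (suc i) = C i

  insertAt : ℕ → X → (ℕ → X) → ℕ → X
  insertAt zero    z C = z ◂ C
  insertAt (suc n) z C = C 0 ◂ insertAt n z (C ∘ suc)

  insertAt-at : ∀ n {z C} → insertAt n z C n ≡ z
  insertAt-at zero    = refl
  insertAt-at (suc n) = insertAt-at n

  insertAt-suc : ∀ n {z C} → insertAt n z C (suc n) ≡ C n
  insertAt-suc zero    = refl
  insertAt-suc (suc n) = insertAt-suc n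

module _ {X : Set} {P : X → Set} {Q : X → X → Set} where

  Chain-prefix : ∀ {r r′ C} → r′ ≤ r → Chain P Q r C → Chain P Q r′ C
  Chain-prefix r′≤r c = record
    { member = λ i i≤r′ → member c i (≤-trans i≤r′ r′≤r)
    ; link   = λ i i<r′ → link c i (≤-trans i<r′ r′≤r)
    }

  Chain-tail : ∀ {r C} → Chain P Q (suc r) C → Chain P Q r (C ∘ suc)
  Chain-tail c = record
    { member = λ i i≤r → member c (suc i) (s≤s i≤r)
    ; link   = λ i i<r → link c (suc i) (s≤s i<r)
    }

  Chain-segment : ∀ {r d j C} → d + j ≤ r → Chain P Q r C → Chain P Q d (λ i → C (i + j))
  Chain-segment {j = j} d+j≤r c = record
    { member = λ i i≤d → member c (i + j) (≤-trans (+-monoˡ-≤ j i≤d) d+j≤r)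
    ; link   = λ i i<d → link c (i + j) (≤-trans (+-monoˡ-≤ j i<d) d+j≤r)
    }

  Chain-◂ : ∀ {r C z} → P z → Q z (C 0) → Chain P Q r C → Chain P Q (suc r) (z ◂ C)
  Chain-◂ {r} {C} {z} pz qz c = record { member = member′ ; link = link′ }
    where
    member′ : ∀ i → i ≤ suc r → P ((z ◂ C) i)
    member′ zero    _         = pz
    member′ (suc i) (s≤s i≤r) = member c i i≤r
    link′ : ∀ i → suc i ≤ suc r → Q ((z ◂ C) i) ((z ◂ C) (suc i))
    link′ zero    _         = qz
    link′ (suc i) (s≤s i<r) = link c i i<r

  Chain-insert : ∀ n {r C z} → suc n ≤ r → Chain P Q r C →
                 P z → Q (C n) z → Q z (C (suc n)) → Chain P Q (suc r) (insertAt (suc n) z C)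
  Chain-insert zero    (s≤s _)   c pz qCz qzC = Chain-◂ (member c 0 z≤n) qCz (Chain-◂ pz qzC (Chain-tail c))
  Chain-insert (suc n) (s≤s n<r) c pz qCz qzC =
    Chain-◂ (member c 0 z≤n) (link c 0 (s≤s z≤n)) (Chain-insert n n<r (Chain-tail c) pz qCz qzC)

  Chain-trans : ∀ {R : X → X → Set} {r C i j} → (∀ {Z} → R Z Z) → (∀ {Z W V} → R Z W → R W V → R Z V) →
                (∀ {Z W} → Q Z W → R Z W) → Chain P Q r C → i ≤ j → j ≤ r → R (C i) (C j)
  Chain-trans {R = R} {r} {C} {i} R-refl R-trans Q⇒R c i≤j = go (≤⇒≤′ i≤j)
    where
    go : ∀ {j} → i ≤′ j → j ≤ r → R (C i) (C j)
    go ≤′-refl                  _   = R-refl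
    go {suc j} (≤′-step i≤′j) j<r = R-trans (go i≤′j (<⇒≤ j<r)) (Q⇒R (link c j j<r))

_⊑_ : (Z W : Subset n × Subset n) → Set
Z ⊑ W = proj₁ Z ⊆ proj₁ W × proj₂ W ⊆ proj₂ Z

⊑-refl : ∀ {Z : Subset n × Subset n} → Z ⊑ Z
⊑-refl = ⊆-refl , ⊆-refl

⊑-trans : ∀ {Z W V : Subset n × Subset n} → Z ⊑ W → W ⊑ V → Z ⊑ V
⊑-trans (A⊆A′ , B′⊆B) (A′⊆A″ , B″⊆B′) = ⊆-trans A⊆A′ A′⊆A″ , ⊆-trans B″⊆B′ B′⊆B

GaplessStep : (Z W : Subset n × Subset n) → Set
GaplessStep Z W = Z ⊑ W × (∣ proj₁ W ─ proj₁ Z ∣ ≤ 1 ⊎ ∣ proj₂ Z ─ proj₂ W ∣ ≤ 1)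

GaplessStep-refl : ∀ {Z : Subset n × Subset n} → GaplessStep Z Z
GaplessStep-refl {Z = A , _} = ⊑-refl , inj₁ (∣p─p∣≤1 A)

-- Every vertex of A′ ∩ B lies in A ∩ B or in A′ ─ A, and also in A′ ∩ B′ or in B ─ B′.
crossing-bound : ∀ {k} {Z W : Subset n × Subset n} → GaplessStep Z W →
                 ∣ proj₁ Z ∩ proj₂ Z ∣ ≤ k → ∣ proj₁ W ∩ proj₂ W ∣ ≤ k → ∣ proj₁ W ∩ proj₂ Z ∣ ≤ suc k
crossing-bound {Z = A , B} {W = A′ , B′} (_ , inj₁ gap) ∣A∩B∣≤k _ =
  ≤-trans (∣p∩r∣≤∣p─q∣+∣q∩r∣ A′ A B) (+-mono-≤ gap ∣A∩B∣≤k)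
crossing-bound {Z = A , B} {W = A′ , B′} (_ , inj₂ gap) _ ∣A′∩B′∣≤k = begin
  ∣ A′ ∩ B ∣             ≡⟨ cong ∣_∣ (∩-comm A′ B) ⟩
  ∣ B ∩ A′ ∣             ≤⟨ ∣p∩r∣≤∣p─q∣+∣q∩r∣ B B′ A′ ⟩
  ∣ B ─ B′ ∣ + ∣ B′ ∩ A′ ∣ ≡⟨ cong (∣ B ─ B′ ∣ +_) (cong ∣_∣ (∩-comm B′ A′)) ⟩
  ∣ B ─ B′ ∣ + ∣ A′ ∩ B′ ∣ ≤⟨ +-mono-≤ gap ∣A′∩B′∣≤k ⟩
  suc _                  ∎
  where open ≤-Reasoning

module _ {G : Digraph} {A B : VSet G} (sep : IsSeparation G (A , B)) where

  ∉ʳ⇒∈ˡ : ∀ {x} → x ∉ B → x ∈ A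
  ∉ʳ⇒∈ˡ {x} x∉B = [ id , (λ x∈B → contradiction x∈B x∉B) ] (proj₁ sep x)

  ∉ˡ⇒∈ʳ : ∀ {x} → x ∉ A → x ∈ B
  ∉ˡ⇒∈ʳ {x} x∉A = [ (λ x∈A → contradiction x∈A x∉A) , id ] (proj₁ sep x)

  separation-growˡ : ∀ {A′} → A ⊆ A′ → IsSeparation G (A′ , B)
  separation-growˡ A⊆A′ =
    (λ x → map₁ A⊆A′ (proj₁ sep x)) ,
    λ x y _ x∉B y∈B y∉A′ → proj₂ sep x y (∉ʳ⇒∈ˡ x∉B) x∉B y∈B (y∉A′ ∘ A⊆A′)

  separation-growʳ : ∀ {B′} → B ⊆ B′ → IsSeparation G (A , B′)
  separation-growʳ B⊆B′ =
    (λ x → map₂ B⊆B′ (proj₁ sep x)) ,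
    λ x y x∈A x∉B′ _ y∉A → proj₂ sep x y x∈A (x∉B′ ∘ B⊆B′) (∉ˡ⇒∈ʳ y∉A) y∉A

  ∉InClosedInNbhd : ∀ {T x} → A ⊆ ∁ T → x ∈ A → x ∉ B → ¬ InClosedInNbhd G T x
  ∉InClosedInNbhd A⊆∁T x∈A x∉B (inj₁ x∈T) = x∈∁p⇒x∉p (A⊆∁T x∈A) x∈T
  ∉InClosedInNbhd {x = x} A⊆∁T x∈A x∉B (inj₂ (t , t∈T , x→t)) =
    contradiction (trans (sym x→t) (proj₂ sep x t x∈A x∉B (∉ˡ⇒∈ʳ t∉A) t∉A)) λ ()
    where
    t∉A : t ∉ A
    t∉A t∈A = x∈∁p⇒x∉p (A⊆∁T t∈A) t∈T

  ∉InClosedOutNbhd : ∀ {S x} → B ⊆ ∁ S → x ∈ B → x ∉ A → ¬ InClosedOutNbhd G S x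
  ∉InClosedOutNbhd B⊆∁S x∈B x∉A (inj₁ x∈S) = x∈∁p⇒x∉p (B⊆∁S x∈B) x∈S
  ∉InClosedOutNbhd {x = x} B⊆∁S x∈B x∉A (inj₂ (s , s∈S , s→x)) =
    contradiction (trans (sym s→x) (proj₂ sep s x (∉ʳ⇒∈ˡ s∉B) s∉B x∈B x∉A)) λ ()
    where
    s∉B : s ∉ B
    s∉B s∈B = x∈∁p⇒x∉p (B⊆∁S s∈B) s∈S

Disjoint-∪⁅⁆ˡ : ∀ {G} {S T : VSet G} {x} → Disjoint {G} S T → x ∉ T → Disjoint {G} (S ∪ ⁅ x ⁆) T
Disjoint-∪⁅⁆ˡ {S = S} {T} {x} disjoint x∉T y y∈S∪x y∈T =
  [ (λ y∈S → disjoint y y∈S y∈T) , (λ y∈x → x∉T (subst (_∈ T) (x∈⁅y⁆⇒x≡y x y∈x) y∈T)) ]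
    (x∈p∪q⁻ S ⁅ x ⁆ y∈S∪x)

Disjoint-∪⁅⁆ʳ : ∀ {G} {S T : VSet G} {x} → Disjoint {G} S T → x ∉ S → Disjoint {G} S (T ∪ ⁅ x ⁆)
Disjoint-∪⁅⁆ʳ {S = S} {T} {x} disjoint x∉S y y∈S y∈T∪x =
  [ disjoint y y∈S , (λ y∈x → x∉S (subst (_∈ S) (x∈⁅y⁆⇒x≡y x y∈x) y∈S)) ]
    (x∈p∪q⁻ T ⁅ x ⁆ y∈T∪x)

BoundedSeparation : (G : Digraph) → ℕ → Pair G → Set
BoundedSeparation G k Z = IsSeparation G Z × order {G} Z ≤ k

GaplessChain : (G : Digraph) → ℕ → ℕ → (ℕ → Pair G) → Set
GaplessChain G k = Chain (BoundedSeparation G k) GaplessStep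

module _ {G : Digraph} {k r : ℕ} {C : ℕ → Pair G} where

  STChain⇒GaplessChain : ∀ {S T} → IsSTChain G S T r C → Gapless G r C → ChainOrder≤ G r C k →
                         GaplessChain G k r C
  STChain⇒GaplessChain (_ , (sep , nested) , _) gapless bounded = record
    { member = λ i i≤r → sep i i≤r , bounded i i≤r
    ; link   = λ i i<r → nested i i<r , gapless i i<r
    }

  module _ (chain : GaplessChain G k r C) where

    GaplessChain⇒IsSTChain : ∀ {S T} → Disjoint {G} S T →
                             proj₂ (C 0) ≡ ∁ S → proj₁ (C r) ≡ ∁ T → IsSTChain G S T r C
    GaplessChain⇒IsSTChain disjoint B₀≡∁S Aᵣ≡∁T =
      disjoint ,
      ((λ i i≤r → proj₁ (member chain i i≤r)) , (λ i i<r → proj₁ (link chain i i<r))) ,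
      B₀≡∁S , Aᵣ≡∁T

    GaplessChain⇒Gapless : Gapless G r C
    GaplessChain⇒Gapless i i<r = proj₂ (link chain i i<r)

    GaplessChain⇒ChainOrder≤ : ChainOrder≤ G r C k
    GaplessChain⇒ChainOrder≤ i i≤r = proj₂ (member chain i i≤r)

    GaplessChain-⊑ : ∀ {i j} → i ≤ j → j ≤ r → C i ⊑ C j
    GaplessChain-⊑ = Chain-trans ⊑-refl ⊑-trans proj₁ chain

    GaplessChain-B⊆B₀ : ∀ {i} → i ≤ r → proj₂ (C i) ⊆ proj₂ (C 0)
    GaplessChain-B⊆B₀ i≤r = proj₂ (GaplessChain-⊑ z≤n i≤r)

    GaplessChain-A⊆Aᵣ : ∀ {i} → i ≤ r → proj₁ (C i) ⊆ proj₁ (C r)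
    GaplessChain-A⊆Aᵣ i≤r = proj₁ (GaplessChain-⊑ i≤r ≤-refl)

record TightChain (G : Digraph) (S T : VSet G) (k : ℕ) : Set where
  field
    d     : ℕ
    E     : ℕ → Pair G
    chain : GaplessChain G k (2 + d) E
    B₀≡∁S : proj₂ (E 0) ≡ ∁ S
    Aᵣ≡∁T : proj₁ (E (2 + d)) ≡ ∁ T
    u     : V G
    u∉S   : u ∉ S
    u∉B₁  : u ∉ proj₂ (E 1)
    v     : V G
    v∉T   : v ∉ T
    v∉Aₗ  : v ∉ proj₁ (E (1 + d))

module Tighten {G : Digraph} {S T : VSet G} {k m : ℕ} {D : ℕ → Pair G}
  (chain : GaplessChain G k m D) (B₀≡∁S : proj₂ (D 0) ≡ ∁ S) (Aₘ≡∁T : proj₁ (D m) ≡ ∁ T)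
  (interior : k + 2 ≤ ∣ ∁ (S ∪ T) ∣) where

  no-spanning-step : ∀ {Z W} → GaplessStep Z W → BoundedSeparation G k Z → BoundedSeparation G k W →
                     ∁ S ⊆ proj₂ Z → ∁ T ⊆ proj₁ W → Empty.⊥
  no-spanning-step {Z} {W} step (_ , ∣Z∣≤k) (_ , ∣W∣≤k) ∁S⊆B ∁T⊆A′ = 1+n≰n (begin
    2 + k                   ≡⟨ +-comm 2 k ⟩
    k + 2                   ≤⟨ interior ⟩
    ∣ ∁ (S ∪ T) ∣           ≤⟨ p⊆q⇒∣p∣≤∣q∣ (λ x∈ → x∈p∩q⁺ (∁T⊆A′ (∁[p∪q]⊆∁q S T x∈) , ∁S⊆B (∁[p∪q]⊆∁p S T x∈))) ⟩
    ∣ proj₁ W ∩ proj₂ Z ∣   ≤⟨ crossing-bound step ∣Z∣≤k ∣W∣≤k ⟩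
    suc k                   ∎)
    where open ≤-Reasoning

  last-B≡∁S : ∃ λ j → suc j ≤ m × proj₂ (D j) ≡ ∁ S × ∃ λ u → u ∉ S × u ∉ proj₂ (D (suc j))
  last-B≡∁S with boundary (λ i → ∁ S ⊆? proj₂ (D i)) (⊆-reflexive (sym B₀≡∁S)) ∁S⊈Bₘ
    where
    ∁S⊈Bₘ : ∁ S ⊈ proj₂ (D m)
    ∁S⊈Bₘ ∁S⊆Bₘ = no-spanning-step GaplessStep-refl (member chain m ≤-refl) (member chain m ≤-refl)
                    ∁S⊆Bₘ (⊆-reflexive (sym Aₘ≡∁T))
  ... | j , j<m , ∁S⊆Bⱼ , ∁S⊈Bⱼ₊₁ with ⊈-witness ∁S⊈Bⱼ₊₁
  ... | u , u∈∁S , u∉Bⱼ₊₁ =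
    j , j<m , ⊆-antisym (subst (_ ⊆_) B₀≡∁S (GaplessChain-B⊆B₀ chain (<⇒≤ j<m))) ∁S⊆Bⱼ ,
    u , x∈∁p⇒x∉p u∈∁S , u∉Bⱼ₊₁

  first-A≡∁T : ∃ λ l → suc l ≤ m × proj₁ (D (suc l)) ≡ ∁ T × ∃ λ v → v ∉ T × v ∉ proj₁ (D l)
  first-A≡∁T with boundary (λ i → ¬? (∁ T ⊆? proj₁ (D i))) ∁T⊈A₀ (λ ∁T⊈Aₘ → ∁T⊈Aₘ (⊆-reflexive (sym Aₘ≡∁T)))
    where
    ∁T⊈A₀ : ∁ T ⊈ proj₁ (D 0)
    ∁T⊈A₀ = no-spanning-step GaplessStep-refl (member chain 0 z≤n) (member chain 0 z≤n)
              (⊆-reflexive (sym B₀≡∁S))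
  ... | l , l<m , ∁T⊈Aₗ , ¬∁T⊈Aₗ₊₁ with ⊈-witness ∁T⊈Aₗ
  ... | v , v∈∁T , v∉Aₗ =
    l , l<m , ⊆-antisym (subst (_ ⊆_) Aₘ≡∁T (GaplessChain-A⊆Aᵣ chain l<m)) ∁T⊆Aₗ₊₁ ,
    v , x∈∁p⇒x∉p v∈∁T , v∉Aₗ
    where
    ∁T⊆Aₗ₊₁ : ∁ T ⊆ proj₁ (D (suc l))
    ∁T⊆Aₗ₊₁ = decidable-stable (∁ T ⊆? proj₁ (D (suc l))) ¬∁T⊈Aₗ₊₁

  segment : ∀ j p l → suc (p + j) ≡ l → suc l ≤ m → proj₂ (D j) ≡ ∁ S → proj₁ (D (suc l)) ≡ ∁ T →
            ∀ {u v} → u ∉ S → u ∉ proj₂ (D (suc j)) → v ∉ T → v ∉ proj₁ (D l) → TightChain G S T k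
  segment j p _ refl l<m Bⱼ≡∁S Aₗ₊₁≡∁T {u} {v} u∉S u∉Bⱼ₊₁ v∉T v∉Aₗ = record
    { d = p ; E = λ i → D (i + j) ; chain = Chain-segment l<m chain
    ; B₀≡∁S = Bⱼ≡∁S ; Aᵣ≡∁T = Aₗ₊₁≡∁T
    ; u = u ; u∉S = u∉S ; u∉B₁ = u∉Bⱼ₊₁
    ; v = v ; v∉T = v∉T ; v∉Aₗ = v∉Aₗ
    }

  tight : TightChain G S T k
  tight with last-B≡∁S | first-A≡∁T
  ... | j , j<m , Bⱼ≡∁S , u , u∉S , u∉Bⱼ₊₁ | l , l<m , Aₗ₊₁≡∁T , v , v∉T , v∉Aₗ with suc j ≤? l
  ... | yes j<l = segment j (l ∸ suc j) l (trans (sym (+-suc _ j)) (m∸n+n≡m j<l)) l<m Bⱼ≡∁S Aₗ₊₁≡∁T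
                    u∉S u∉Bⱼ₊₁ v∉T v∉Aₗ
  ... | no j≮l  = ⊥-elim (no-spanning-step (link chain j j<m)
                    (member chain j (<⇒≤ j<m)) (member chain (suc j) j<m) (⊆-reflexive (sym Bⱼ≡∁S))
                    (⊆-trans (⊆-reflexive (sym Aₗ₊₁≡∁T)) (proj₁ (GaplessChain-⊑ chain (≰⇒> j≮l) j<m))))

Refinement : (G : Digraph) (S T : VSet G) (k : ℕ) → Set
Refinement G S T k =
  Σ ℕ (λ r → Σ (ℕ → Pair G) (λ C → Σ (V G) (λ u → Σ (V G) (λ v →
    (IsSTChain G S T r C × Gapless G r C × ChainOrder≤ G r C k) ×
    2 ≤ r ×
    ¬ (u ≡ v) ×
    u ∉ S × ¬ InClosedInNbhd G T u ×
    v ∉ T × ¬ InClosedOutNbhd G S v ×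
    IsSTChain G (S ∪ ⁅ u ⁆) T (r ∸ 1) (λ i → C (suc i)) ×
    IsSTChain G S (T ∪ ⁅ v ⁆) (r ∸ 1) C ×
    IsSTChain G (S ∪ ⁅ u ⁆) (T ∪ ⁅ v ⁆) (r ∸ 2) (λ i → C (suc i))))))

module Refine {G : Digraph} {S T : VSet G} {k : ℕ} (disjoint : Disjoint {G} S T) (tc : TightChain G S T k) where
  open TightChain tc

  private
    A B : ℕ → VSet G
    A i = proj₁ (E i)
    B i = proj₂ (E i)

    sep : ∀ i → i ≤ 2 + d → IsSeparation G (E i)
    sep i i≤r = proj₁ (member chain i i≤r)

    ord : ∀ i → i ≤ 2 + d → order {G} (E i) ≤ k
    ord i i≤r = proj₂ (member chain i i≤r)

    1≤r : 1 ≤ 2 + d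
    1≤r = s≤s z≤n

    l≤r : 1 + d ≤ 2 + d
    l≤r = n≤1+n _

  B⊆∁S : ∀ {i} → i ≤ 2 + d → B i ⊆ ∁ S
  B⊆∁S {i} i≤r = subst (B i ⊆_) B₀≡∁S (GaplessChain-B⊆B₀ chain i≤r)

  A⊆∁T : ∀ {i} → i ≤ 2 + d → A i ⊆ ∁ T
  A⊆∁T {i} i≤r = subst (A i ⊆_) Aᵣ≡∁T (GaplessChain-A⊆Aᵣ chain i≤r)

  u∈A₁ : u ∈ A 1
  u∈A₁ = ∉ʳ⇒∈ˡ (sep 1 1≤r) u∉B₁

  v∈Bₗ : v ∈ B (1 + d)
  v∈Bₗ = ∉ˡ⇒∈ʳ (sep (1 + d) l≤r) v∉Aₗ

  u≢v : u ≢ v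
  u≢v u≡v = v∉Aₗ (subst (_∈ A (1 + d)) u≡v (proj₁ (GaplessChain-⊑ chain (s≤s z≤n) l≤r) u∈A₁))

  u∉T : u ∉ T
  u∉T = x∈∁p⇒x∉p (A⊆∁T 1≤r u∈A₁)

  v∉S : v ∉ S
  v∉S = x∈∁p⇒x∉p (B⊆∁S l≤r v∈Bₗ)

  X Y : Pair G
  X = A 1 , ∁ (S ∪ ⁅ u ⁆)
  Y = ∁ (T ∪ ⁅ v ⁆) , B (1 + d)

  B₁⊆∁[S∪u] : B 1 ⊆ ∁ (S ∪ ⁅ u ⁆)
  B₁⊆∁[S∪u] = q⊆∁[p∪⁅x⁆] (B⊆∁S 1≤r) u∉B₁

  Aₗ⊆∁[T∪v] : A (1 + d) ⊆ ∁ (T ∪ ⁅ v ⁆)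
  Aₗ⊆∁[T∪v] = q⊆∁[p∪⁅x⁆] (A⊆∁T l≤r) v∉Aₗ

  X-bounded : BoundedSeparation G k X
  X-bounded = separation-growʳ (sep 1 1≤r) B₁⊆∁[S∪u] , ≤-pred (begin-strict
    ∣ A 1 ∩ ∁ (S ∪ ⁅ u ⁆) ∣ <⟨ ∣p∩∁[q∪⁅x⁆]∣<∣p∩∁q∣ u∈A₁ u∉S ⟩
    ∣ A 1 ∩ ∁ S ∣           ≡⟨ cong (λ b → ∣ A 1 ∩ b ∣) (sym B₀≡∁S) ⟩
    ∣ A 1 ∩ B 0 ∣           ≤⟨ crossing-bound (link chain 0 1≤r) (ord 0 z≤n) (ord 1 1≤r) ⟩
    suc k                   ∎)
    where open ≤-Reasoning

  Y-bounded : BoundedSeparation G k Y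
  Y-bounded = separation-growˡ (sep (1 + d) l≤r) Aₗ⊆∁[T∪v] , ≤-pred (begin-strict
    ∣ ∁ (T ∪ ⁅ v ⁆) ∩ B (1 + d) ∣ <⟨ ∣∁[q∪⁅x⁆]∩p∣<∣∁q∩p∣ v∈Bₗ v∉T ⟩
    ∣ ∁ T ∩ B (1 + d) ∣           ≡⟨ cong (λ a → ∣ a ∩ B (1 + d) ∣) (sym Aᵣ≡∁T) ⟩
    ∣ A (2 + d) ∩ B (1 + d) ∣     ≤⟨ crossing-bound (link chain (1 + d) ≤-refl)
                                                    (ord (1 + d) l≤r) (ord (2 + d) ≤-refl) ⟩
    suc k                         ∎)
    where open ≤-Reasoning

  E₀→X : GaplessStep (E 0) X
  E₀→X = (proj₁ (proj₁ (link chain 0 1≤r)) ,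
          subst (∁ (S ∪ ⁅ u ⁆) ⊆_) (sym B₀≡∁S) (∁[p∪q]⊆∁p S ⁅ u ⁆)) ,
         inj₂ (subst (λ b → ∣ b ─ ∁ (S ∪ ⁅ u ⁆) ∣ ≤ 1) (sym B₀≡∁S) (∣∁p─∁[p∪⁅x⁆]∣≤1 S u))

  X→E₁ : GaplessStep X (E 1)
  X→E₁ = (⊆-refl , B₁⊆∁[S∪u]) , inj₁ (∣p─p∣≤1 (A 1))

  Eₗ→Y : GaplessStep (E (1 + d)) Y
  Eₗ→Y = (Aₗ⊆∁[T∪v] , ⊆-refl) , inj₂ (∣p─p∣≤1 (B (1 + d)))

  Y→Eᵣ : GaplessStep Y (E (2 + d))
  Y→Eᵣ = (subst (∁ (T ∪ ⁅ v ⁆) ⊆_) (sym Aᵣ≡∁T) (∁[p∪q]⊆∁p T ⁅ v ⁆) ,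
          proj₂ (proj₁ (link chain (1 + d) ≤-refl))) ,
         inj₁ (subst (λ a → ∣ a ─ ∁ (T ∪ ⁅ v ⁆) ∣ ≤ 1) (sym Aᵣ≡∁T) (∣∁p─∁[p∪⁅x⁆]∣≤1 T v))

  C : ℕ → Pair G
  C = insertAt (3 + d) Y (insertAt 1 X E)

  C-chain : GaplessChain G k (4 + d) C
  C-chain = Chain-insert (2 + d) {C = insertAt 1 X E} ≤-refl
            (Chain-insert 0 {C = E} 1≤r chain X-bounded E₀→X X→E₁) Y-bounded Eₗ→Y Y→Eᵣ

  Aᵣ≡∁[T∪v] : proj₁ (C (3 + d)) ≡ ∁ (T ∪ ⁅ v ⁆)
  Aᵣ≡∁[T∪v] = cong proj₁ (insertAt-at (3 + d) {C = insertAt 1 X E})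

  Aᵣ₊₁≡∁T : proj₁ (C (4 + d)) ≡ ∁ T
  Aᵣ₊₁≡∁T = trans (cong proj₁ (insertAt-suc (3 + d) {Y} {insertAt 1 X E})) Aᵣ≡∁T

  refinement : Refinement G S T k
  refinement =
    4 + d , C , u , v ,
    (GaplessChain⇒IsSTChain C-chain disjoint B₀≡∁S Aᵣ₊₁≡∁T ,
     GaplessChain⇒Gapless C-chain , GaplessChain⇒ChainOrder≤ C-chain) ,
    s≤s (s≤s z≤n) , u≢v ,
    u∉S , ∉InClosedInNbhd (sep 1 1≤r) (A⊆∁T 1≤r) u∈A₁ u∉B₁ ,
    v∉T , ∉InClosedOutNbhd (sep (1 + d) l≤r) (B⊆∁S l≤r) v∈Bₗ v∉Aₗ ,
    GaplessChain⇒IsSTChain (Chain-tail C-chain) disjoint-u refl Aᵣ₊₁≡∁T ,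
    GaplessChain⇒IsSTChain C-chain⁻ disjoint-v B₀≡∁S Aᵣ≡∁[T∪v] ,
    GaplessChain⇒IsSTChain (Chain-tail C-chain⁻) disjoint-uv refl Aᵣ≡∁[T∪v]
    where
    C-chain⁻ : GaplessChain G k (3 + d) C
    C-chain⁻ = Chain-prefix (n≤1+n _) C-chain
    disjoint-u : Disjoint {G} (S ∪ ⁅ u ⁆) T
    disjoint-u = Disjoint-∪⁅⁆ˡ {G} disjoint u∉T
    disjoint-v : Disjoint {G} S (T ∪ ⁅ v ⁆)
    disjoint-v = Disjoint-∪⁅⁆ʳ {G} disjoint v∉S
    disjoint-uv : Disjoint {G} (S ∪ ⁅ u ⁆) (T ∪ ⁅ v ⁆)
    disjoint-uv = Disjoint-∪⁅⁆ʳ {G} disjoint-u (x∉p∪⁅y⁆ v∉S (u≢v ∘ sym))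

lemma6 : (G : Digraph) (S T : VSet G) (k : ℕ) →
  Disjoint {G} S T →
  Σ ℕ (λ r → Σ (ℕ → Pair G) (λ C →
    IsSTChain G S T r C × Gapless G r C × ChainOrder≤ G r C k)) →
  k + 2 ≤ ∣ ∁ (S ∪ T) ∣ →
  Σ ℕ (λ r → Σ (ℕ → Pair G) (λ C → Σ (V G) (λ u → Σ (V G) (λ v →
    (IsSTChain G S T r C × Gapless G r C × ChainOrder≤ G r C k) ×
    2 ≤ r ×
    ¬ (u ≡ v) ×
    u ∉ S × ¬ InClosedInNbhd G T u ×
    v ∉ T × ¬ InClosedOutNbhd G S v ×
    IsSTChain G (S ∪ ⁅ u ⁆) T (r ∸ 1) (λ i → C (suc i)) ×
    IsSTChain G S (T ∪ ⁅ v ⁆) (r ∸ 1) C ×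
    IsSTChain G (S ∪ ⁅ u ⁆) (T ∪ ⁅ v ⁆) (r ∸ 2) (λ i → C (suc i))))))
lemma6 G S T k disjoint (_ , _ , st@(_ , _ , B₀≡∁S , Aₘ≡∁T) , gapless , bounded) interior =
  Refine.refinement disjoint (Tighten.tight (STChain⇒GaplessChain st gapless bounded) B₀≡∁S Aₘ≡∁T interior)
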